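{- Let $z\in(0,1)$ be irrational with $z\in[r_1,r_2]$ for some rationals $r_1,r_2\in(0,1)$. Suppose that the continued fraction expansions of $r_1,r_2$ are either of the form $$r_1=[(2)^{2k-1},(2,1)^\ell,s,a_1,\dots,a_{n_1},\infty],\qquad r_2=[(2)^{2k-1},b_1,\dots,b_{n_2},\infty],$$ or of the form $$r_1=[(2)^{2k},a_1,\dots,a_{n_1},\infty],\qquad r_2=[(2)^{2k},(2,1)^\ell,s,b_1,\dots,b_{n_2},\infty],$$ where $k\ge1$, $\ell\ge0$, $s\ge3$ are integers and the $a_i,b_i$ are positive integers. Then $z\notin\mathcal{B}_2$.
   Context: $[c_1,c_2,\dots]$ denotes the simple continued fraction $\cfrac{1}{c_1+\cfrac{1}{c_2+\cdots}}$ with positive integer partial quotients; for rationals, $[c_1,\dots,c_n,\infty]$ denotes the finite continued fraction $\cfrac{1}{c_1+\cfrac{1}{\ddots+\cfrac{1}{c_n}}}$. The notation $(c_1,\dots,c_m)^\ell$ means the block $c_1,\dots,c_m$ repeated $\ell$ times (zero times if $\ell=0$), and $(2)^m$ means $2$ repeated $m$ times. $\mathcal{B}_2$ is the set of irrational $x\in(0,1)$ all of whose partial quotients are at most $2$. -}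

module Defs where

open import Data.Nat using (ℕ; zero; suc; _+_; _*_; _≤_)
open import Data.Product using (_×_; _,_)
open import Data.List using (List; []; _∷_; _++_; replicate; concat; applyUpTo)
import Data.Integer as ℤ
open import Data.Rational using (ℚ; 0ℚ; _/_) renaming (_≤_ to _≤ℚ_)

-- Numerator/denominator of the finite continued fraction
-- [c1,...,cn,∞] = 1/(c1 + 1/(c2 + ... + 1/cn)), with [] ↦ 0/1.
cfPQ : List ℕ → ℕ × ℕ
cfPQ [] = 0 , 1
cfPQ (c ∷ cs) with cfPQ cs
... | p , q = q , c * q + p

-- p/q as a rational (the denominator-0 case never arises when all
-- partial quotients are positive; it is mapped to 0 as junk).
frac : ℕ → ℕ → ℚ
frac p zero    = 0ℚ
frac p (suc q) = ℤ.+ p / suc q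

cfVal : List ℕ → ℚ
cfVal cs with cfPQ cs
... | p , q = frac p q

-- An irrational number z ∈ (0,1) is represented by its (infinite) sequence
-- of partial quotients c : ℕ → ℕ, with c 0 = c₁, all ≥ 1:  z = [c 0, c 1, ...].

convergent : (ℕ → ℕ) → ℕ → ℚ
convergent c m = cfVal (applyUpTo c m)

-- z ≤ r : every even-length convergent (these increase to z) is ≤ r,
-- i.e. sup of the lower convergents is ≤ r.
CFLeQ : (ℕ → ℕ) → ℚ → Set
CFLeQ c r = ∀ m → convergent c (2 * m) ≤ℚ r

-- r ≤ z : every odd-length convergent (these decrease to z) is ≥ r.
QLeCF : ℚ → (ℕ → ℕ) → Set
QLeCF r c = ∀ m → r ≤ℚ convergent c (suc (2 * m))

InB2 : (ℕ → ℕ) → Set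
InB2 c = ∀ i → c i ≤ 2

block21 : ℕ → List ℕ
block21 ℓ = concat (replicate ℓ (2 ∷ 1 ∷ []))

-- Let z ∈ B₂ and let (2)ⁿ be the common prefix of r₁ and r₂. Read z against it
-- one quotient at a time: a quotient 1 puts z above every [2, …], and a quotient
-- 2 strips one layer and reverses the order. So z ∈ [r₁, r₂] would force the
-- shifted tail of z into [t₁, t₂] (n even) or [t₂, t₁] (n odd), where t₁, t₂ are
-- the tails of r₁, r₂ after the prefix. In both cases the tail carrying the block
-- is [(2,1)^ℓ, s, …], and it lies strictly below every element of B₂: for ℓ = 0
-- because s > 2, and otherwise because an element of B₂ either begins with 1, or
-- begins with 2, 2 (and then exceeds [2, 1, …]), or begins with 2, 1 and one
-- strips both layers and uses induction.
module Submission where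

open import Defs
open import Data.Nat using (ℕ; zero; suc; _+_; _*_; _∸_; _≤_; _<_; z≤n; s≤s)
open import Data.Nat.Properties
open import Data.Nat.Solver using (module +-*-Solver)
open import Data.Product using (_×_; _,_; proj₁; proj₂)
open import Data.Sum using (_⊎_; inj₁; inj₂)
open import Data.List using (List; []; _∷_; _++_; replicate; applyUpTo)
open import Data.List.Relation.Unary.All as All using (All; []; _∷_)
open import Data.List.Relation.Unary.All.Properties using (++⁺; replicate⁺; applyUpTo⁺₂)
open import Relation.Binary.PropositionalEquality using (_≡_; refl; cong; subst; subst₂; sym)
open import Relation.Nullary using (¬_)
import Data.Integer as ℤ
import Data.Integer.Properties as ℤ
open import Data.Rational using () renaming (_≤_ to _≤ℚ_)
import Data.Rational.Properties as ℚ
import Data.Rational.Unnormalised as ℚᵘ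
import Data.Rational.Unnormalised.Properties as ℚᵘ

-- (p , q) stands for p/q and cons d for x ↦ 1/(d + x), so that
-- cfPQ (d ∷ l) is definitionally cons d (cfPQ l).
cons : ℕ → ℕ × ℕ → ℕ × ℕ
cons d (p , q) = q , d * q + p

_≺_ : ℕ × ℕ → ℕ × ℕ → Set
(p , q) ≺ (p′ , q′) = p * q′ < p′ * q

cons-antitone : ∀ d {X Y} → X ≺ Y → cons d Y ≺ cons d X
cons-antitone d {p , q} {p′ , q′} p/q<p′/q′ = begin-strict
  q′ * (d * q + p)      ≡⟨ solve 4 (λ d p q q′ → q′ :* (d :* q :+ p) := q :* (d :* q′) :+ p :* q′) refl d p q q′ ⟩
  q * (d * q′) + p * q′ <⟨ +-monoʳ-< (q * (d * q′)) p/q<p′/q′ ⟩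
  q * (d * q′) + p′ * q ≡⟨ solve 4 (λ d p′ q q′ → q :* (d :* q′) :+ p′ :* q := q :* (d :* q′ :+ p′)) refl d p′ q q′ ⟩
  q * (d * q′ + p′)     ∎
  where open ≤-Reasoning; open +-*-Solver

cons-≺-cons : ∀ {d s Y Z} → suc d ≤ s → 1 ≤ proj₂ Y → proj₁ Z < proj₂ Z → cons s Y ≺ cons d Z
cons-≺-cons {d} {s} {p , suc q} {a , b} d<s _ a<b = begin-strict
  suc q * (d * b + a) <⟨ *-monoʳ-< (suc q) (+-monoʳ-< (d * b) a<b) ⟩
  suc q * (d * b + b) ≡⟨ solve 3 (λ q d b → q :* (d :* b :+ b) := b :* ((con 1 :+ d) :* q)) refl (suc q) d b ⟩
  b * (suc d * suc q) ≤⟨ *-monoʳ-≤ b (*-monoˡ-≤ (suc q) d<s) ⟩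
  b * (s * suc q)     ≤⟨ *-monoʳ-≤ b (m≤m+n (s * suc q) p) ⟩
  b * (s * suc q + p) ∎
  where open ≤-Reasoning; open +-*-Solver

cons-≺-cons1 : ∀ {e Y} → 2 ≤ e → proj₁ Y < proj₂ Y → cons e (0 , 1) ≺ cons 1 Y
cons-≺-cons1 {e} {p , q} 2≤e p<q = begin-strict
  1 * (1 * q + p) ≡⟨ solve 2 (λ p q → con 1 :* (con 1 :* q :+ p) := q :+ p) refl p q ⟩
  q + p           <⟨ +-monoʳ-< q p<q ⟩
  q + q           ≡⟨ solve 1 (λ q → q :+ q := q :* con 2) refl q ⟩
  q * 2           ≤⟨ *-monoʳ-≤ q 2≤e ⟩
  q * e           ≡⟨ solve 2 (λ q e → q :* e := q :* (e :* con 1 :+ con 0)) refl q e ⟩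
  q * (e * 1 + 0) ∎
  where open ≤-Reasoning; open +-*-Solver

den-cons-pos : ∀ {d X} → 1 ≤ d → 1 ≤ proj₂ X → 1 ≤ proj₂ (cons d X)
den-cons-pos {d} {p , q} 1≤d 1≤q = ≤-trans (*-mono-≤ 1≤d 1≤q) (m≤m+n (d * q) p)

num<den-cons : ∀ {d X} → 1 ≤ d → 1 ≤ proj₁ X → proj₁ (cons d X) < proj₂ (cons d X)
num<den-cons {suc d} {p , q} _ 1≤p = ≤-<-trans (m≤m+n q (d * q)) (m<m+n (q + d * q) 1≤p)

num<den-cons₂ : ∀ {d X} → 2 ≤ d → 1 ≤ proj₂ X → proj₁ (cons d X) < proj₂ (cons d X)
num<den-cons₂ {suc (suc d)} {p , q} _ 1≤q = begin-strict
  q                     <⟨ m<m+n q 1≤q ⟩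
  q + q                 ≤⟨ +-monoʳ-≤ q (m≤m+n q (d * q)) ⟩
  q + (q + d * q)       ≤⟨ m≤m+n _ p ⟩
  q + (q + d * q) + p   ∎
  where open ≤-Reasoning
num<den-cons₂ {suc zero} (s≤s ())

cfPQ-den-pos : ∀ {l} → All (1 ≤_) l → 1 ≤ proj₂ (cfPQ l)
cfPQ-den-pos []         = s≤s z≤n
cfPQ-den-pos (1≤d ∷ ps) = den-cons-pos 1≤d (cfPQ-den-pos ps)

frac-≤⇒≤ : ∀ {p q p′ q′} → frac p (suc q) ≤ℚ frac p′ (suc q′) → p * suc q′ ≤ p′ * suc q
frac-≤⇒≤ {p} {q} {p′} {q′} p/q≤p′/q′ = ℤ.drop‿+≤+
  (subst₂ ℤ._≤_ (sym (ℤ.pos-* p (suc q′))) (sym (ℤ.pos-* p′ (suc q)))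
    (ℚᵘ.drop-*≤*
      (ℚᵘ.≤-respʳ-≃ (ℚ.toℚᵘ-fromℚᵘ (ℚᵘ.mkℚᵘ (ℤ.+ p′) q′))
        (ℚᵘ.≤-respˡ-≃ (ℚ.toℚᵘ-fromℚᵘ (ℚᵘ.mkℚᵘ (ℤ.+ p) q))
          (ℚ.toℚᵘ-mono-≤ p/q≤p′/q′)))))

frac-≤⇒⊀ : ∀ {X Y} → 1 ≤ proj₂ X → 1 ≤ proj₂ Y →
  frac (proj₁ X) (proj₂ X) ≤ℚ frac (proj₁ Y) (proj₂ Y) → ¬ Y ≺ X
frac-≤⇒⊀ {p , suc q} {p′ , suc q′} _ _ X≤Y Y≺X = <⇒≱ Y≺X (frac-≤⇒≤ {p} {q} {p′} {q′} X≤Y)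

Pos : (ℕ → ℕ) → Set
Pos c = ∀ i → 1 ≤ c i

tail : (ℕ → ℕ) → ℕ → ℕ
tail c i = c (suc i)

conv : (ℕ → ℕ) → ℕ → ℕ × ℕ
conv c n = cfPQ (applyUpTo c n)

conv-den-pos : ∀ {c} → Pos c → ∀ n → 1 ≤ proj₂ (conv c n)
conv-den-pos pc n = cfPQ-den-pos (applyUpTo⁺₂ _ n pc)

-- Strict comparisons with z = [c 0, c 1, …], witnessed by a convergent:
-- the even ones lie below z and the odd ones above.
data _≺ᶻ_ (X : ℕ × ℕ) (c : ℕ → ℕ) : Set where
  ≺-even-conv : ∀ m → X ≺ conv c (2 * m) → X ≺ᶻ c

data _ᶻ≺_ (c : ℕ → ℕ) (X : ℕ × ℕ) : Set where
  odd-conv-≺ : ∀ m → conv c (suc (2 * m)) ≺ X → c ᶻ≺ X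

≺ᶻ-cons : ∀ {c d X} → c 0 ≡ d → X ≺ᶻ tail c → c ᶻ≺ cons d X
≺ᶻ-cons {c} {_} {X} refl (≺-even-conv m X≺) =
  odd-conv-≺ m (cons-antitone (c 0) {X} {conv (tail c) (2 * m)} X≺)

ᶻ≺-cons : ∀ {c d X} → c 0 ≡ d → tail c ᶻ≺ X → cons d X ≺ᶻ c
ᶻ≺-cons {c} {_} {X} refl (odd-conv-≺ m ≺X) =
  ≺-even-conv (suc m) (subst (λ n → cons (c 0) X ≺ conv c n) (sym (*-suc 2 m))
    (cons-antitone (c 0) {conv (tail c) (suc (2 * m))} {X} ≺X))

cons-≺ᶻ : ∀ {c s Y} → Pos c → c 0 < s → 1 ≤ proj₂ Y → cons s Y ≺ᶻ c
cons-≺ᶻ pc c₀<s 1≤q =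
  ≺-even-conv 2 (cons-≺-cons c₀<s 1≤q (num<den-cons (pc 1) (conv-den-pos (λ i → pc (3 + i)) 1)))

ᶻ≺-cons1 : ∀ {c Y} → 2 ≤ c 0 → proj₁ Y < proj₂ Y → c ᶻ≺ cons 1 Y
ᶻ≺-cons1 2≤c₀ Y<1 = odd-conv-≺ 0 (cons-≺-cons1 2≤c₀ Y<1)

one-or-two : ∀ {n} → 1 ≤ n → n ≤ 2 → n ≡ 1 ⊎ n ≡ 2
one-or-two {1} _ _ = inj₁ refl
one-or-two {2} _ _ = inj₂ refl
one-or-two {suc (suc (suc _))} _ (s≤s (s≤s ()))

block21-pos : ∀ ℓ → All (1 ≤_) (block21 ℓ)
block21-pos zero    = []
block21-pos (suc ℓ) = s≤s z≤n ∷ s≤s z≤n ∷ block21-pos ℓ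

block21-++-pos : ∀ ℓ {s as} → 3 ≤ s → All (1 ≤_) as → All (1 ≤_) (block21 ℓ ++ s ∷ as)
block21-++-pos ℓ 3≤s ps = ++⁺ (block21-pos ℓ) (≤-trans (s≤s z≤n) 3≤s ∷ ps)

block21-num<den : ∀ ℓ {s as} → 3 ≤ s → All (1 ≤_) as →
  proj₁ (cfPQ (block21 ℓ ++ s ∷ as)) < proj₂ (cfPQ (block21 ℓ ++ s ∷ as))
block21-num<den zero    3≤s ps = num<den-cons₂ (≤-trans (s≤s (s≤s z≤n)) 3≤s) (cfPQ-den-pos ps)
block21-num<den (suc ℓ) 3≤s ps =
  num<den-cons₂ ≤-refl (cfPQ-den-pos (All.tail (block21-++-pos (suc ℓ) 3≤s ps)))

block21-≺ᶻ : ∀ ℓ {s as} → 3 ≤ s → All (1 ≤_) as →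
  ∀ c → Pos c → InB2 c → cfPQ (block21 ℓ ++ s ∷ as) ≺ᶻ c
block21-≺ᶻ zero 3≤s ps c pc b = cons-≺ᶻ pc (≤-trans (s≤s (b 0)) 3≤s) (cfPQ-den-pos ps)
block21-≺ᶻ (suc ℓ) {s} {as} 3≤s ps c pc b with one-or-two (pc 0) (b 0)
... | inj₁ c₀≡1 =
  cons-≺ᶻ pc (≤-reflexive (cong suc c₀≡1)) (cfPQ-den-pos (All.tail (block21-++-pos (suc ℓ) 3≤s ps)))
... | inj₂ c₀≡2 = ᶻ≺-cons c₀≡2 tail-above
  where
  tail-above : tail c ᶻ≺ cfPQ (1 ∷ block21 ℓ ++ s ∷ as)
  tail-above with one-or-two (pc 1) (b 1)
  ... | inj₁ c₁≡1 =
    ≺ᶻ-cons c₁≡1 (block21-≺ᶻ ℓ 3≤s ps (tail (tail c)) (λ i → pc (2 + i)) (λ i → b (2 + i)))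
  ... | inj₂ c₁≡2 = ᶻ≺-cons1 (≤-reflexive (sym c₁≡2)) (block21-num<den ℓ 3≤s ps)

B₂-avoids : ℕ × ℕ → ℕ × ℕ → Set
B₂-avoids X Y = ∀ c → Pos c → InB2 c → c ᶻ≺ X ⊎ Y ≺ᶻ c

B₂-avoids-cons2 : ∀ {X Y} → 1 ≤ proj₂ Y → B₂-avoids Y X → B₂-avoids (cons 2 X) (cons 2 Y)
B₂-avoids-cons2 1≤q avoids c pc b with one-or-two (pc 0) (b 0)
... | inj₁ c₀≡1 = inj₂ (cons-≺ᶻ pc (≤-reflexive (cong suc c₀≡1)) 1≤q)
... | inj₂ c₀≡2 with avoids (tail c) (λ i → pc (suc i)) (λ i → b (suc i))
...   | inj₁ above = inj₂ (ᶻ≺-cons c₀≡2 above)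
...   | inj₂ below = inj₁ (≺ᶻ-cons c₀≡2 below)

replicate2-++-pos : ∀ n {t} → All (1 ≤_) t → All (1 ≤_) (replicate n 2 ++ t)
replicate2-++-pos n ps = ++⁺ (replicate⁺ n (s≤s z≤n)) ps

B₂-avoids-replicate2-even : ∀ m {t₁ t₂} → All (1 ≤_) t₁ → All (1 ≤_) t₂ →
  B₂-avoids (cfPQ t₁) (cfPQ t₂) →
  B₂-avoids (cfPQ (replicate (2 * m) 2 ++ t₁)) (cfPQ (replicate (2 * m) 2 ++ t₂))
B₂-avoids-replicate2-even zero              _  _  avoids = avoids
B₂-avoids-replicate2-even (suc m) {t₁} {t₂} p₁ p₂ avoids =
  subst (λ n → B₂-avoids (cfPQ (replicate n 2 ++ t₁)) (cfPQ (replicate n 2 ++ t₂)))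
    (sym (*-suc 2 m))
    (B₂-avoids-cons2 (cfPQ-den-pos (replicate2-++-pos (suc (2 * m)) p₂))
      (B₂-avoids-cons2 (cfPQ-den-pos (replicate2-++-pos (2 * m) p₁))
        (B₂-avoids-replicate2-even m p₁ p₂ avoids)))

B₂-avoids-replicate2-odd : ∀ k {t₁ t₂} → All (1 ≤_) t₁ → All (1 ≤_) t₂ →
  B₂-avoids (cfPQ t₂) (cfPQ t₁) →
  B₂-avoids (cfPQ (replicate (2 * suc k ∸ 1) 2 ++ t₁)) (cfPQ (replicate (2 * suc k ∸ 1) 2 ++ t₂))
B₂-avoids-replicate2-odd k {t₁} {t₂} p₁ p₂ avoids =
  subst (λ n → B₂-avoids (cfPQ (replicate n 2 ++ t₁)) (cfPQ (replicate n 2 ++ t₂)))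
    (sym (cong (_∸ 1) (*-suc 2 k)))
    (B₂-avoids-cons2 (cfPQ-den-pos (replicate2-++-pos (2 * k) p₂))
      (B₂-avoids-replicate2-even k p₂ p₁ avoids))

bounded⇒¬outside : ∀ {c l₁ l₂} → Pos c → All (1 ≤_) l₁ → All (1 ≤_) l₂ →
  QLeCF (cfVal l₁) c → CFLeQ c (cfVal l₂) → ¬ (c ᶻ≺ cfPQ l₁ ⊎ cfPQ l₂ ≺ᶻ c)
bounded⇒¬outside pc p₁ _  l₁≤z _   (inj₁ (odd-conv-≺ m ≺l₁)) =
  frac-≤⇒⊀ (cfPQ-den-pos p₁) (conv-den-pos pc (suc (2 * m))) (l₁≤z m) ≺l₁
bounded⇒¬outside pc _  p₂ _   z≤l₂ (inj₂ (≺-even-conv m l₂≺)) =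
  frac-≤⇒⊀ (conv-den-pos pc (2 * m)) (cfPQ-den-pos p₂) (z≤l₂ m) l₂≺

lemma5p1 : (c : ℕ → ℕ) → (∀ i → 1 ≤ c i) →
    (k ℓ s : ℕ) → 1 ≤ k → 3 ≤ s →
    (as bs : List ℕ) → All (1 ≤_) as → All (1 ≤_) bs →
    ((QLeCF (cfVal (replicate (2 * k ∸ 1) 2 ++ block21 ℓ ++ s ∷ as)) c
       × CFLeQ c (cfVal (replicate (2 * k ∸ 1) 2 ++ bs)))
     ⊎ (QLeCF (cfVal (replicate (2 * k) 2 ++ as)) c
       × CFLeQ c (cfVal (replicate (2 * k) 2 ++ block21 ℓ ++ s ∷ bs)))) →
    ¬ InB2 c
lemma5p1 c pc (suc k) ℓ s _ 3≤s as bs pas pbs (inj₁ (r₁≤z , z≤r₂)) b =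
  bounded⇒¬outside pc (replicate2-++-pos n pts) (replicate2-++-pos n pbs) r₁≤z z≤r₂
    (B₂-avoids-replicate2-odd k pts pbs (λ c′ pc′ b′ → inj₂ (block21-≺ᶻ ℓ 3≤s pas c′ pc′ b′)) c pc b)
  where
  n = 2 * suc k ∸ 1
  pts = block21-++-pos ℓ 3≤s pas
lemma5p1 c pc (suc k) ℓ s _ 3≤s as bs pas pbs (inj₂ (r₁≤z , z≤r₂)) b =
  bounded⇒¬outside pc (replicate2-++-pos n pas) (replicate2-++-pos n pts) r₁≤z z≤r₂
    (B₂-avoids-replicate2-even (suc k) pas pts (λ c′ pc′ b′ → inj₂ (block21-≺ᶻ ℓ 3≤s pbs c′ pc′ b′)) c pc b)
  where
  n = 2 * suc k
  pts = block21-++-pos ℓ 3≤s pbs
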